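{- Let $k$ and $n$ be integers with $2\le k\le n$, and let $q,r$ be the unique integers with $n=kq+r$ and $0\le r<k$. Then there exists a (not necessarily connected) $k^*$-dense graph on $n$ vertices with exactly $q\binom{k}{2}+\binom{r}{2}+r(k-r)$ edges.
   Context: All graphs are finite and simple. For an edge $uv$ of a graph $G$, the edge multiplicity is $m_G(uv)=|N_G(u)\cap N_G(v)|$. For an integer $k\ge 2$, a graph $G$ is called $k$-dense if $G$ has no isolated vertices and every edge $uv$ of $G$ satisfies $m_G(uv)\ge k-2$. A graph is $k^*$-dense if it is $k$-dense but not $(k+1)$-dense. Here $\binom{r}{2}=0$ for $r<2$. -}

module Defs where

open import Data.Bool using (Bool; true; false; _∧_)
open import Data.Nat using (ℕ; zero; suc; _+_; _*_; _∸_; _≤_; _<ᵇ_)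
open import Data.Nat.Combinatorics using (_C_)
open import Data.Fin using (Fin; toℕ)
open import Data.List using (List; length; filterᵇ; concatMap; map)
open import Data.List using (allFin)
open import Data.Product using (_×_; _,_; ∃)
open import Relation.Binary.PropositionalEquality using (_≡_)
open import Relation.Nullary using (¬_)

record Graph (n : ℕ) : Set where
  field
    adj    : Fin n → Fin n → Bool
    sym    : ∀ u v → adj u v ≡ adj v u
    irrefl : ∀ v → adj v v ≡ false
open Graph public

count : {n : ℕ} → (Fin n → Bool) → ℕ
count {n} p = length (filterᵇ p (allFin n))

edgeCount : {n : ℕ} → Graph n → ℕ
edgeCount {n} G =
  length (filterᵇ (λ { (u , v) → (toℕ u <ᵇ toℕ v) ∧ adj G u v })
                  (concatMap (λ u → map (λ v → (u , v)) (allFin n)) (allFin n)))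

mult : {n : ℕ} → Graph n → Fin n → Fin n → ℕ
mult G u v = count (λ w → adj G u w ∧ adj G v w)

-- k-dense: no isolated vertices and every edge uv has m_G(uv) ≥ k - 2
-- (only used for k ≥ 2, so truncated subtraction agrees with k - 2)
Dense : {n : ℕ} → ℕ → Graph n → Set
Dense {n} k G =
  (∀ (v : Fin n) → ∃ λ (u : Fin n) → adj G v u ≡ true)
  × (∀ (u v : Fin n) → adj G u v ≡ true → k ∸ 2 ≤ mult G u v)

DenseStar : {n : ℕ} → ℕ → Graph n → Set
DenseStar k G = Dense k G × ¬ Dense (suc k) G

module Submission where

-- Vertices are 0, …, n-1.  Cut [0, qk) into q blocks of length k and let the
-- last r vertices share the window [n - k, n).  Two vertices x < y are joined
-- iff x lies in the window of y.  So the graph is q disjoint copies of K_k plus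
-- r vertices, each forming a K_k with the k - r last vertices of the last block.

open import Defs using (Graph; adj; count; mult; edgeCount; Dense; DenseStar)

open import Data.Bool using (Bool; true; false; T; not; _∧_; _∨_)
open import Data.Bool.Properties using (T-∧; T-∨; T-≡; T-not-≡; ∧-zeroʳ; ∧-identityʳ; ∨-comm)
open import Data.Empty using (⊥-elim)
open import Data.Fin using (Fin; toℕ; fromℕ<)
open import Data.Fin.Properties using (toℕ-fromℕ<; toℕ<n)
open import Data.List using (List; []; _∷_; length; map; concatMap; filterᵇ; tabulate; allFin; _++_)
open import Data.List.Properties using (map-++; map-∘; map-cong; map-tabulate)
open import Data.Nat using (ℕ; zero; suc; _+_; _*_; _∸_; _⊓_; NonZero; _≤_; _<_; _≤ᵇ_; _<ᵇ_; _≡ᵇ_; z≤n; s≤s)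
open import Data.Nat.Combinatorics using (_C_; nCk+nC[k+1]≡[n+1]C[k+1]; nC1≡n)
open import Data.Nat.DivMod using (_/_; _%_; m≡m%n+[m/n]*n; m%n≡m∸m/n*n; [m+kn]%n≡m%n; m<n⇒m%n≡m; m%n<n; m/n*n≤m; m<n*o⇒m/o<n; m<n⇒m/n≡0; m*n/n≡m; /-monoˡ-≤)
open import Data.Nat.ListAction using (sum)
open import Data.Nat.ListAction.Properties using (sum-++)
open import Data.Nat.Properties
open import Data.Nat.Tactic.RingSolver using (solve-∀)
open import Data.Product using (Σ; ∃; _×_; _,_; proj₁; proj₂)
open import Data.Sum using (inj₁; inj₂)
open import Data.Unit using (tt)
open import Function using (_∘_)
open import Function.Bundles using (Equivalence)
open import Relation.Binary.PropositionalEquality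
open import Relation.Nullary using (¬_; yes; no)
open import Relation.Binary.Definitions using (tri<; tri≈; tri>)

open Equivalence using (to; from)

∑< : ℕ → (ℕ → ℕ) → ℕ
∑< zero    f = 0
∑< (suc n) f = ∑< n f + f n

∑-cong : ∀ n {f g : ℕ → ℕ} → (∀ {i} → i < n → f i ≡ g i) → ∑< n f ≡ ∑< n g
∑-cong zero    f≡g = refl
∑-cong (suc n) f≡g = cong₂ _+_ (∑-cong n (f≡g ∘ m≤n⇒m≤1+n)) (f≡g ≤-refl)

∑-mono : ∀ n {f g : ℕ → ℕ} → (∀ {i} → i < n → f i ≤ g i) → ∑< n f ≤ ∑< n g
∑-mono zero    f≤g = z≤n
∑-mono (suc n) f≤g = +-mono-≤ (∑-mono n (f≤g ∘ m≤n⇒m≤1+n)) (f≤g ≤-refl)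

∑-zero : ∀ n → ∑< n (λ _ → 0) ≡ 0
∑-zero zero    = refl
∑-zero (suc n) = cong (_+ 0) (∑-zero n)

∑-distrib-+ : ∀ n (f g : ℕ → ℕ) → ∑< n (λ i → f i + g i) ≡ ∑< n f + ∑< n g
∑-distrib-+ zero    f g = refl
∑-distrib-+ (suc n) f g = begin
  ∑< n (λ i → f i + g i) + (f n + g n) ≡⟨ cong (_+ (f n + g n)) (∑-distrib-+ n f g) ⟩
  ∑< n f + ∑< n g + (f n + g n)        ≡⟨ +-+-swap (∑< n f) (∑< n g) (f n) (g n) ⟩
  ∑< n f + f n + (∑< n g + g n)        ∎
  where
  open ≡-Reasoning
  +-+-swap : ∀ a b c d → a + b + (c + d) ≡ a + c + (b + d)
  +-+-swap = solve-∀

∑-comm : ∀ m n (f : ℕ → ℕ → ℕ) →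
  ∑< m (λ i → ∑< n (f i)) ≡ ∑< n (λ j → ∑< m (λ i → f i j))
∑-comm zero    n f = sym (∑-zero n)
∑-comm (suc m) n f = begin
  ∑< m (λ i → ∑< n (f i)) + ∑< n (f m)               ≡⟨ cong (_+ ∑< n (f m)) (∑-comm m n f) ⟩
  ∑< n (λ j → ∑< m (λ i → f i j)) + ∑< n (f m)       ≡⟨ sym (∑-distrib-+ n _ (f m)) ⟩
  ∑< n (λ j → ∑< m (λ i → f i j) + f m j)            ∎
  where open ≡-Reasoning

∑-split : ∀ a b (f : ℕ → ℕ) → ∑< (a + b) f ≡ ∑< a f + ∑< b (λ j → f (a + j))
∑-split a zero    f = trans (cong (λ m → ∑< m f) (+-identityʳ a)) (sym (+-identityʳ _))
∑-split a (suc b) f = begin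
  ∑< (a + suc b) f                          ≡⟨ cong (λ m → ∑< m f) (+-suc a b) ⟩
  ∑< (a + b) f + f (a + b)                  ≡⟨ cong (_+ f (a + b)) (∑-split a b f) ⟩
  ∑< a f + ∑< b (λ j → f (a + j)) + f (a + b) ≡⟨ +-assoc (∑< a f) _ _ ⟩
  ∑< a f + ∑< (suc b) (λ j → f (a + j))     ∎
  where open ≡-Reasoning

∑-shift : ∀ n (f : ℕ → ℕ) → ∑< (suc n) f ≡ f 0 + ∑< n (f ∘ suc)
∑-shift n f = ∑-split 1 n f

∑-arith : ∀ m c → ∑< m (λ j → c + j) ≡ m * c + m C 2
∑-arith zero    c = refl
∑-arith (suc m) c = begin
  ∑< m (λ j → c + j) + (c + m)       ≡⟨ cong (_+ (c + m)) (∑-arith m c) ⟩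
  m * c + m C 2 + (c + m)            ≡⟨ regroup (m * c) (m C 2) c m ⟩
  c + m * c + (m + m C 2)            ≡⟨ cong (λ t → c + m * c + (t + m C 2)) (sym (nC1≡n m)) ⟩
  c + m * c + (m C 1 + m C 2)        ≡⟨ cong (c + m * c +_) (nCk+nC[k+1]≡[n+1]C[k+1] m 1) ⟩
  suc m * c + suc m C 2              ∎
  where
  open ≡-Reasoning
  regroup : ∀ a b c m → a + b + (c + m) ≡ c + a + (m + b)
  regroup = solve-∀

χ : Bool → ℕ
χ true  = 1
χ false = 0

#< : ℕ → (ℕ → Bool) → ℕ
#< n p = ∑< n (χ ∘ p)

χ-mono : ∀ {a b} → (T a → T b) → χ a ≤ χ b
χ-mono {false}         _   = z≤n
χ-mono {true}  {true}  _   = ≤-refl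
χ-mono {true}  {false} a⇒b = ⊥-elim (a⇒b tt)

χ-cong : ∀ {a b} → (T a → T b) → (T b → T a) → χ a ≡ χ b
χ-cong a⇒b b⇒a = ≤-antisym (χ-mono a⇒b) (χ-mono b⇒a)

¬T⇒≡false : ∀ {b} → ¬ T b → b ≡ false
¬T⇒≡false {false} _  = refl
¬T⇒≡false {true}  ¬b = ⊥-elim (¬b tt)

χ-false : ∀ {a} → ¬ T a → χ a ≡ 0
χ-false ¬a = cong χ (¬T⇒≡false ¬a)

#-mono : ∀ n {p q : ℕ → Bool} → (∀ {i} → i < n → T (p i) → T (q i)) → #< n p ≤ #< n q
#-mono n p⇒q = ∑-mono n (λ i<n → χ-mono (p⇒q i<n))

_∈[_,_⟩ : ℕ → ℕ → ℕ → Bool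
i ∈[ a , b ⟩ = (a ≤ᵇ i) ∧ (i <ᵇ b)

_≠ᵇ_ : ℕ → ℕ → Bool
i ≠ᵇ u = not (i ≡ᵇ u)

∈[]-intro : ∀ {i a b} → a ≤ i → i < b → T (i ∈[ a , b ⟩)
∈[]-intro a≤i i<b = from T-∧ (≤⇒≤ᵇ a≤i , <⇒<ᵇ i<b)

∈[]-elim : ∀ {i a b} → T (i ∈[ a , b ⟩) → a ≤ i × i < b
∈[]-elim {i} {a} {b} t with to T-∧ t
... | a≤ᵇi , i<ᵇb = ≤ᵇ⇒≤ a i a≤ᵇi , <ᵇ⇒< i b i<ᵇb

≠ᵇ-intro : ∀ {i u} → i ≢ u → T (i ≠ᵇ u)
≠ᵇ-intro {i} {u} i≢u = from T-not-≡ (¬T⇒≡false (i≢u ∘ ≡ᵇ⇒≡ i u))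

≠ᵇ-elim : ∀ {i u} → T (i ≠ᵇ u) → i ≢ u
≠ᵇ-elim {i} {u} t i≡u = subst T (to T-not-≡ t) (≡⇒≡ᵇ i u i≡u)

#-atLeast : ∀ n a → #< n (a ≤ᵇ_) ≡ n ∸ a
#-atLeast zero    a = sym (0∸n≡0 a)
#-atLeast (suc n) a with a ≤? n
... | yes a≤n = begin
  #< n (a ≤ᵇ_) + χ (a ≤ᵇ n) ≡⟨ cong₂ _+_ (#-atLeast n a) (χ-cong (λ _ → tt) (λ _ → ≤⇒≤ᵇ a≤n)) ⟩
  n ∸ a + 1                 ≡⟨ +-comm (n ∸ a) 1 ⟩
  suc (n ∸ a)               ≡⟨ sym (+-∸-assoc 1 a≤n) ⟩
  suc n ∸ a                 ∎
  where open ≡-Reasoning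
... | no a≰n = begin
  #< n (a ≤ᵇ_) + χ (a ≤ᵇ n) ≡⟨ cong₂ _+_ (#-atLeast n a) (χ-false (a≰n ∘ ≤ᵇ⇒≤ a n)) ⟩
  n ∸ a + 0                 ≡⟨ cong (_+ 0) (m≤n⇒m∸n≡0 (<⇒≤ (≰⇒> a≰n))) ⟩
  0                         ≡⟨ sym (m≤n⇒m∸n≡0 (≰⇒> a≰n)) ⟩
  suc n ∸ a                 ∎
  where open ≡-Reasoning

#-below : ∀ n b (p : ℕ → Bool) → #< n (λ i → p i ∧ (i <ᵇ b)) ≡ #< (n ⊓ b) p
#-below zero    b p = refl
#-below (suc n) b p with n <? b
... | yes n<b = begin
  #< n (λ i → p i ∧ (i <ᵇ b)) + χ (p n ∧ (n <ᵇ b)) ≡⟨ cong₂ _+_ (#-below n b p) (χ-cong (proj₁ ∘ to T-∧) (λ t → from T-∧ (t , <⇒<ᵇ n<b))) ⟩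
  #< (n ⊓ b) p + χ (p n)                          ≡⟨ cong (λ m → #< m p + χ (p n)) (m≤n⇒m⊓n≡m (<⇒≤ n<b)) ⟩
  #< (suc n) p                                    ≡⟨ cong (λ m → #< m p) (sym (m≤n⇒m⊓n≡m n<b)) ⟩
  #< (suc n ⊓ b) p                                ∎
  where open ≡-Reasoning
... | no n≮b = begin
  #< n (λ i → p i ∧ (i <ᵇ b)) + χ (p n ∧ (n <ᵇ b)) ≡⟨ cong₂ _+_ (#-below n b p) (χ-false (n≮b ∘ <ᵇ⇒< n b ∘ proj₂ ∘ to T-∧)) ⟩
  #< (n ⊓ b) p + 0                                ≡⟨ +-identityʳ _ ⟩
  #< (n ⊓ b) p                                    ≡⟨ cong (λ m → #< m p) (m≥n⇒m⊓n≡n (≮⇒≥ n≮b)) ⟩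
  #< b p                                          ≡⟨ cong (λ m → #< m p) (sym (m≥n⇒m⊓n≡n (≤-trans (≮⇒≥ n≮b) (n≤1+n n)))) ⟩
  #< (suc n ⊓ b) p                                ∎
  where open ≡-Reasoning

#-interval : ∀ {n} a b → b ≤ n → #< n (_∈[ a , b ⟩) ≡ b ∸ a
#-interval {n} a b b≤n = begin
  #< n (_∈[ a , b ⟩)  ≡⟨ #-below n b (a ≤ᵇ_) ⟩
  #< (n ⊓ b) (a ≤ᵇ_)  ≡⟨ cong (λ m → #< m (a ≤ᵇ_)) (m≥n⇒m⊓n≡n b≤n) ⟩
  #< b (a ≤ᵇ_)        ≡⟨ #-atLeast b a ⟩
  b ∸ a               ∎
  where open ≡-Reasoning

#-singleton : ∀ {n u} → u < n → #< n (_≡ᵇ u) ≡ 1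
#-singleton {n} {u} u<n = begin
  #< n (_≡ᵇ u)             ≡⟨ ∑-cong n (λ _ → χ-cong to-interval from-interval) ⟩
  #< n (_∈[ u , suc u ⟩)   ≡⟨ #-interval u (suc u) u<n ⟩
  suc u ∸ u                ≡⟨ m+n∸n≡m 1 u ⟩
  1                        ∎
  where
  open ≡-Reasoning
  to-interval : ∀ {i} → T (i ≡ᵇ u) → T (i ∈[ u , suc u ⟩)
  to-interval {i} t with ≡ᵇ⇒≡ i u t
  ... | refl = ∈[]-intro {i} ≤-refl ≤-refl
  from-interval : ∀ {i} → T (i ∈[ u , suc u ⟩) → T (i ≡ᵇ u)
  from-interval {i} t with ∈[]-elim t
  ... | u≤i , i<1+u = ≡⇒≡ᵇ i u (≤-antisym (≤-pred i<1+u) u≤i)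

#-remove : ∀ {n u} (p : ℕ → Bool) → u < n → T (p u) → #< n (λ i → p i ∧ (i ≠ᵇ u)) + 1 ≡ #< n p
#-remove {n} {u} p u<n pu = begin
  #< n (λ i → p i ∧ (i ≠ᵇ u)) + 1              ≡⟨ cong (#< n (λ i → p i ∧ (i ≠ᵇ u)) +_) (sym (#-singleton u<n)) ⟩
  #< n (λ i → p i ∧ (i ≠ᵇ u)) + #< n (_≡ᵇ u)   ≡⟨ sym (∑-distrib-+ n _ _) ⟩
  ∑< n (λ i → χ (p i ∧ (i ≠ᵇ u)) + χ (i ≡ᵇ u)) ≡⟨ ∑-cong n (λ {i} _ → split i) ⟩
  #< n p                                        ∎
  where
  open ≡-Reasoning
  split : ∀ i → χ (p i ∧ (i ≠ᵇ u)) + χ (i ≡ᵇ u) ≡ χ (p i)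
  split i with i ≡ᵇ u in eq
  ... | false = trans (+-identityʳ _) (cong χ (∧-identityʳ (p i)))
  ... | true with ≡ᵇ⇒≡ i u (subst T (sym eq) tt)
  ...   | refl = trans (cong (λ b → χ b + 1) (∧-zeroʳ (p i))) (sym (χ-cong (λ _ → tt) (λ _ → pu)))

#-interval-minus-two : ∀ {n a b x y} → b ≤ n → x ≢ y →
  T (x ∈[ a , b ⟩) → T (y ∈[ a , b ⟩) →
  #< n (λ i → (i ∈[ a , b ⟩ ∧ (i ≠ᵇ x)) ∧ (i ≠ᵇ y)) ≡ (b ∸ a) ∸ 2
#-interval-minus-two {n} {a} {b} {x} {y} b≤n x≢y x∈ y∈ = begin
  rest                    ≡⟨ sym (m+n∸n≡m rest 2) ⟩
  (rest + 2) ∸ 2          ≡⟨ cong (_∸ 2) (sym (+-assoc rest 1 1)) ⟩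
  (rest + 1 + 1) ∸ 2      ≡⟨ cong (λ m → (m + 1) ∸ 2) (#-remove (λ i → i ∈[ a , b ⟩ ∧ (i ≠ᵇ x)) (in-range y∈) y∈∖x) ⟩
  (#< n without-x + 1) ∸ 2 ≡⟨ cong (_∸ 2) (#-remove (_∈[ a , b ⟩) (in-range x∈) x∈) ⟩
  #< n (_∈[ a , b ⟩) ∸ 2  ≡⟨ cong (_∸ 2) (#-interval a b b≤n) ⟩
  (b ∸ a) ∸ 2             ∎
  where
  open ≡-Reasoning
  without-x : ℕ → Bool
  without-x i = i ∈[ a , b ⟩ ∧ (i ≠ᵇ x)
  rest : ℕ
  rest = #< n (λ i → without-x i ∧ (i ≠ᵇ y))
  in-range : ∀ {i} → T (i ∈[ a , b ⟩) → i < n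
  in-range {i} i∈ = <-≤-trans (proj₂ (∈[]-elim {i} {a} i∈)) b≤n
  y∈∖x : T (without-x y)
  y∈∖x = from T-∧ (y∈ , ≠ᵇ-intro (x≢y ∘ sym))

length-filterᵇ : ∀ {A : Set} (p : A → Bool) (xs : List A) → length (filterᵇ p xs) ≡ sum (map (χ ∘ p) xs)
length-filterᵇ p []       = refl
length-filterᵇ p (x ∷ xs) with p x
... | true  = cong suc (length-filterᵇ p xs)
... | false = length-filterᵇ p xs

sum-map-concatMap : ∀ {A B : Set} (f : B → ℕ) (h : A → List B) (xs : List A) →
  sum (map f (concatMap h xs)) ≡ sum (map (λ x → sum (map f (h x))) xs)
sum-map-concatMap f h []       = refl
sum-map-concatMap f h (x ∷ xs) = begin
  sum (map f (h x ++ concatMap h xs))              ≡⟨ cong sum (map-++ f (h x) (concatMap h xs)) ⟩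
  sum (map f (h x) ++ map f (concatMap h xs))      ≡⟨ sum-++ (map f (h x)) _ ⟩
  sum (map f (h x)) + sum (map f (concatMap h xs)) ≡⟨ cong (sum (map f (h x)) +_) (sum-map-concatMap f h xs) ⟩
  sum (map (λ x → sum (map f (h x))) (x ∷ xs))     ∎
  where open ≡-Reasoning

sum-allFin : ∀ n (f : ℕ → ℕ) → sum (map (f ∘ toℕ) (allFin n)) ≡ ∑< n f
sum-allFin n f = trans (cong sum (map-tabulate {n = n} (λ i → i) (f ∘ toℕ))) (sum-tabulate n f)
  where
  sum-tabulate : ∀ n (f : ℕ → ℕ) → sum (tabulate {n = n} (f ∘ toℕ)) ≡ ∑< n f
  sum-tabulate zero    f = refl
  sum-tabulate (suc n) f = trans (cong (f 0 +_) (sum-tabulate n (f ∘ suc))) (sym (∑-shift n f))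

count-as-# : ∀ {n} (p : ℕ → Bool) → count {n} (p ∘ toℕ) ≡ #< n p
count-as-# {n} p = trans (length-filterᵇ (p ∘ toℕ) (allFin n)) (sum-allFin n (χ ∘ p))

count-pairs : ∀ {n} (P : Fin n × Fin n → Bool) (p : ℕ → ℕ → Bool) →
  (∀ u v → P (u , v) ≡ p (toℕ u) (toℕ v)) →
  length (filterᵇ P (concatMap (λ u → map (u ,_) (allFin n)) (allFin n))) ≡ ∑< n (λ x → #< n (p x))
count-pairs {n} P p P≡p = begin
  length (filterᵇ P (concatMap row (allFin n)))         ≡⟨ length-filterᵇ P (concatMap row (allFin n)) ⟩
  sum (map (χ ∘ P) (concatMap row (allFin n)))          ≡⟨ sum-map-concatMap (χ ∘ P) row (allFin n) ⟩
  sum (map (λ u → sum (map (χ ∘ P) (row u))) (allFin n)) ≡⟨ cong sum (map-cong row-sum (allFin n)) ⟩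
  sum (map (λ u → #< n (p (toℕ u))) (allFin n))          ≡⟨ sum-allFin n (λ x → #< n (p x)) ⟩
  ∑< n (λ x → #< n (p x))                               ∎
  where
  open ≡-Reasoning
  row : Fin n → List (Fin n × Fin n)
  row u = map (u ,_) (allFin n)
  row-sum : ∀ u → sum (map (χ ∘ P) (row u)) ≡ #< n (p (toℕ u))
  row-sum u = begin
    sum (map (χ ∘ P) (map (u ,_) (allFin n)))          ≡⟨ cong sum (sym (map-∘ (allFin n))) ⟩
    sum (map (χ ∘ P ∘ (u ,_)) (allFin n))              ≡⟨ cong sum (map-cong (cong χ ∘ P≡p u) (allFin n)) ⟩
    sum (map (χ ∘ p (toℕ u) ∘ toℕ) (allFin n))         ≡⟨ sum-allFin n (χ ∘ p (toℕ u)) ⟩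
    #< n (p (toℕ u))                                  ∎

-- Each vertex v < n is given a window [s v, s v + k) ⊆ [0, n)
-- containing v, such that windows are nested: every y in the window of v has
-- its own window starting no later than that of v.  Two vertices x < y are
-- adjacent iff x lies in the window of y.
module WindowGraph {k n : ℕ} (2≤k : 2 ≤ k) (s : ℕ → ℕ)
  (s≤ : ∀ v → s v ≤ v)
  (<s+k : ∀ {v} → v < n → v < s v + k)
  (s+k≤n : ∀ v → s v + k ≤ n)
  (nested : ∀ {v y} → s v ≤ y → y < s v + k → s y ≤ s v)
  where

  InWindow : ℕ → ℕ → Set
  InWindow v w = s v ≤ w × w < s v + k

  own-window : ∀ {v} → v < n → InWindow v v
  own-window v<n = s≤ _ , <s+k v<n

  _◁_ : ℕ → ℕ → Bool
  x ◁ y = (x <ᵇ y) ∧ (s y ≤ᵇ x)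

  ◁-intro : ∀ {x y} → x < y → s y ≤ x → T (x ◁ y)
  ◁-intro x<y sy≤x = from T-∧ (<⇒<ᵇ x<y , ≤⇒≤ᵇ sy≤x)

  ◁-elim : ∀ {x y} → T (x ◁ y) → x < y × s y ≤ x
  ◁-elim {x} {y} t with to T-∧ t
  ... | x<ᵇy , sy≤ᵇx = <ᵇ⇒< x y x<ᵇy , ≤ᵇ⇒≤ (s y) x sy≤ᵇx

  adjℕ : ℕ → ℕ → Bool
  adjℕ x y = (x ◁ y) ∨ (y ◁ x)

  adjℕ-sym : ∀ x y → adjℕ x y ≡ adjℕ y x
  adjℕ-sym x y = ∨-comm (x ◁ y) (y ◁ x)

  adjℕ-irrefl : ∀ x → ¬ T (adjℕ x x)
  adjℕ-irrefl x t with to (T-∨ {x ◁ x}) t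
  ... | inj₁ x◁x = <-irrefl refl (proj₁ (◁-elim {x} x◁x))
  ... | inj₂ x◁x = <-irrefl refl (proj₁ (◁-elim {x} x◁x))

  window-clique : ∀ {v x y} → InWindow v x → InWindow v y → x ≢ y → T (adjℕ x y)
  window-clique {v} {x} {y} (svx , xin) (svy , yin) x≢y with <-cmp x y
  ... | tri< x<y _ _ = from T-∨ (inj₁ (◁-intro x<y (≤-trans (nested svy yin) svx)))
  ... | tri≈ _ x≡y _ = ⊥-elim (x≢y x≡y)
  ... | tri> _ _ y<x = from T-∨ (inj₂ (◁-intro y<x (≤-trans (nested svx xin) svy)))

  common-in-window : ∀ {v x y} → InWindow v x → InWindow v y → x ≢ y →
    k ∸ 2 ≤ #< n (λ w → adjℕ x w ∧ adjℕ y w)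
  common-in-window {v} {x} {y} x∈ y∈ x≢y = begin
    k ∸ 2                              ≡⟨ cong (_∸ 2) (sym (m+n∸m≡n (s v) k)) ⟩
    (s v + k ∸ s v) ∸ 2                ≡⟨ sym (#-interval-minus-two {n} {s v} (s+k≤n v) x≢y (as-T x∈) (as-T y∈)) ⟩
    #< n (λ w → (window w ∧ (w ≠ᵇ x)) ∧ (w ≠ᵇ y)) ≤⟨ #-mono n common ⟩
    #< n (λ w → adjℕ x w ∧ adjℕ y w)   ∎
    where
    open ≤-Reasoning
    window : ℕ → Bool
    window w = w ∈[ s v , s v + k ⟩
    as-T : ∀ {w} → InWindow v w → T (window w)
    as-T {w} (svw , win) = ∈[]-intro {w} svw win
    common : ∀ {w} → w < n → T ((window w ∧ (w ≠ᵇ x)) ∧ (w ≠ᵇ y)) → T (adjℕ x w ∧ adjℕ y w)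
    common {w} _ t with to T-∧ t
    ... | t₁ , w≠y with to T-∧ t₁
    ... | w∈ , w≠x = from T-∧ ( window-clique x∈ w∈′ (≠ᵇ-elim w≠x ∘ sym)
                              , window-clique y∈ w∈′ (≠ᵇ-elim w≠y ∘ sym))
      where
      w∈′ : InWindow v w
      w∈′ = ∈[]-elim {w} {s v} w∈

  -- Adjacent vertices have at least k - 2 common neighbours, because every
  -- edge lies inside the window of its larger endpoint.
  edge-common : ∀ {x y} → x < n → y < n → T (adjℕ x y) → k ∸ 2 ≤ #< n (λ w → adjℕ x w ∧ adjℕ y w)
  edge-common {x} {y} x<n y<n t with to T-∨ t
  ... | inj₁ x◁y = let (x<y , sy≤x) = ◁-elim x◁y in
    common-in-window (sy≤x , <-trans x<y (<s+k y<n)) (own-window y<n) (<⇒≢ x<y)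
  ... | inj₂ y◁x = let (y<x , sx≤y) = ◁-elim y◁x in
    common-in-window (own-window x<n) (sx≤y , <-trans y<x (<s+k x<n)) (<⇒≢ y<x ∘ sym)

  other-in-window : ∀ {v} → v < n → ∃ λ w → InWindow v w × w ≢ v
  other-in-window {v} v<n with s v ≟ v
  ... | no sv≢v = s v , (≤-refl , m<m+n (s v) (<-≤-trans (s≤s z≤n) 2≤k)) , sv≢v
  ... | yes sv≡v = suc v , (≤-trans (s≤ v) (n≤1+n v) , v+1<) , (<⇒≢ (n<1+n v) ∘ sym)
    where
    v+1< : suc v < s v + k
    v+1< = subst (λ t → suc v < t + k) (sym sv≡v) (subst (_≤ v + k) (+-comm v 2) (+-monoʳ-≤ v 2≤k))

  -- The neighbours of vertex 0 lie in [0, k): any neighbour w has s w ≤ 0.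
  neighbour-of-0 : ∀ {w} → w < n → T (adjℕ 0 w) → w < k
  neighbour-of-0 {w} w<n t with to (T-∨ {0 ◁ w}) t
  ... | inj₁ 0◁w = subst (λ a → w < a + k) (n≤0⇒n≡0 (proj₂ (◁-elim {0} 0◁w))) (<s+k w<n)
  ... | inj₂ w◁0 = ⊥-elim (n≮0 (proj₁ (◁-elim {w} w◁0)))

  -- Vertices 0 and 1 have at most k - 2 common neighbours, all in [0, k) ∖ {0, 1}.
  common-of-0-1 : #< n (λ w → adjℕ 0 w ∧ adjℕ 1 w) ≤ k ∸ 2
  common-of-0-1 = begin
    #< n (λ w → adjℕ 0 w ∧ adjℕ 1 w)                  ≤⟨ #-mono n in-window ⟩
    #< n (λ w → (w ∈[ 0 , k ⟩ ∧ (w ≠ᵇ 0)) ∧ (w ≠ᵇ 1)) ≡⟨ #-interval-minus-two {n} {0} k≤n (λ ()) (∈[]-intro {0} z≤n 0<k) (∈[]-intro {1} z≤n 2≤k) ⟩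
    k ∸ 2                                             ∎
    where
    open ≤-Reasoning
    k≤n : k ≤ n
    k≤n = ≤-trans (m≤n+m k (s 0)) (s+k≤n 0)
    0<k : 0 < k
    0<k = <-≤-trans (s≤s z≤n) 2≤k
    not-loop : ∀ {x w} → T (adjℕ x w) → w ≢ x
    not-loop {x} t refl = adjℕ-irrefl x t
    in-window : ∀ {w} → w < n → T (adjℕ 0 w ∧ adjℕ 1 w) → T ((w ∈[ 0 , k ⟩ ∧ (w ≠ᵇ 0)) ∧ (w ≠ᵇ 1))
    in-window {w} w<n t with to (T-∧ {adjℕ 0 w}) t
    ... | 0~w , 1~w = from T-∧ (from T-∧ (∈[]-intro {w} z≤n (neighbour-of-0 w<n 0~w) , ≠ᵇ-intro {w} (not-loop {0} 0~w))
                               , ≠ᵇ-intro {w} (not-loop {1} 1~w))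

  G : Graph n
  G = record
    { adj    = λ u v → adjℕ (toℕ u) (toℕ v)
    ; sym    = λ u v → adjℕ-sym (toℕ u) (toℕ v)
    ; irrefl = λ v → ¬T⇒≡false (adjℕ-irrefl (toℕ v))
    }

  mult-as-# : ∀ u v → mult G u v ≡ #< n (λ w → adjℕ (toℕ u) w ∧ adjℕ (toℕ v) w)
  mult-as-# u v = count-as-# {n} (λ w → adjℕ (toℕ u) w ∧ adjℕ (toℕ v) w)

  -- no vertex is isolated since windows have k ≥ 2 elements, and edges have
  -- at least k - 2 common neighbours
  dense : Dense k G
  dense = neighbour , edge-mult
    where
    neighbour : ∀ v → ∃ λ u → adj G v u ≡ true
    neighbour v with other-in-window (toℕ<n v)
    ... | w , w∈ , w≢v = fromℕ< w<n , to T-≡ (subst (T ∘ adjℕ (toℕ v)) (sym (toℕ-fromℕ< w<n))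
                                                 (window-clique (own-window (toℕ<n v)) w∈ (w≢v ∘ sym)))
      where
      w<n : w < n
      w<n = <-≤-trans (proj₂ w∈) (s+k≤n (toℕ v))
    edge-mult : ∀ u v → adj G u v ≡ true → k ∸ 2 ≤ mult G u v
    edge-mult u v e = subst (k ∸ 2 ≤_) (sym (mult-as-# u v)) (edge-common (toℕ<n u) (toℕ<n v) (from T-≡ e))

  -- If 0 and 1 are adjacent, the edge 01 has only k - 2 common neighbours.
  not-denser : s 1 ≡ 0 → ¬ Dense (suc k) G
  not-denser s1≡0 (_ , edge-mult) = <-irrefl refl (begin-strict
    k ∸ 2              <⟨ n<1+n (k ∸ 2) ⟩
    1 + (k ∸ 2)        ≡⟨ sym (+-∸-assoc 1 2≤k) ⟩
    suc k ∸ 2          ≤⟨ edge-mult zero′ one′ (to T-≡ 0~1) ⟩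
    mult G zero′ one′  ≡⟨ mult-as-# zero′ one′ ⟩
    #< n (λ w → adjℕ (toℕ zero′) w ∧ adjℕ (toℕ one′) w) ≡⟨ cong₂ (λ a b → #< n (λ w → adjℕ a w ∧ adjℕ b w)) (toℕ-fromℕ< 0<n) (toℕ-fromℕ< 1<n) ⟩
    #< n (λ w → adjℕ 0 w ∧ adjℕ 1 w) ≤⟨ common-of-0-1 ⟩
    k ∸ 2              ∎)
    where
    open ≤-Reasoning
    1<n : 1 < n
    1<n = ≤-trans 2≤k (≤-trans (m≤n+m k (s 0)) (s+k≤n 0))
    0<n : 0 < n
    0<n = <-trans (s≤s z≤n) 1<n
    zero′ one′ : Fin n
    zero′ = fromℕ< 0<n
    one′  = fromℕ< 1<n
    0~1 : T (adjℕ (toℕ zero′) (toℕ one′))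
    0~1 = subst₂ (λ a b → T (adjℕ a b)) (sym (toℕ-fromℕ< 0<n)) (sym (toℕ-fromℕ< 1<n))
                 (from T-∨ (inj₁ (◁-intro (s≤s z≤n) (≤-reflexive s1≡0))))

  -- Counting each edge at its larger endpoint y, which has y - s y smaller neighbours.
  edgeCount-window : edgeCount G ≡ ∑< n (λ y → y ∸ s y)
  edgeCount-window = begin
    edgeCount G                                             ≡⟨ count-pairs {n} _ (λ x y → (x <ᵇ y) ∧ adjℕ x y) (λ _ _ → refl) ⟩
    ∑< n (λ x → #< n (λ y → (x <ᵇ y) ∧ adjℕ x y))           ≡⟨ ∑-comm n n _ ⟩
    ∑< n (λ y → #< n (λ x → (x <ᵇ y) ∧ adjℕ x y))           ≡⟨ ∑-cong n (λ {y} y<n → trans (∑-cong n (λ _ → χ-cong (earlier y) (earlier⁻¹ y)))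
                                                                                      (#-interval (s y) y (<⇒≤ y<n))) ⟩
    ∑< n (λ y → y ∸ s y)                                    ∎
    where
    open ≡-Reasoning
    earlier : ∀ y {x} → T ((x <ᵇ y) ∧ adjℕ x y) → T (x ∈[ s y , y ⟩)
    earlier y {x} t with to (T-∧ {x <ᵇ y}) t
    ... | x<ᵇy , x~y with to (T-∨ {x ◁ y}) x~y
    ...   | inj₁ x◁y = ∈[]-intro {x} (proj₂ (◁-elim {x} x◁y)) (<ᵇ⇒< x y x<ᵇy)
    ...   | inj₂ y◁x = ⊥-elim (<-asym (<ᵇ⇒< x y x<ᵇy) (proj₁ (◁-elim {y} y◁x)))
    earlier⁻¹ : ∀ y {x} → T (x ∈[ s y , y ⟩) → T ((x <ᵇ y) ∧ adjℕ x y)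
    earlier⁻¹ y {x} t with ∈[]-elim {x} {s y} t
    ... | sy≤x , x<y = from T-∧ (<⇒<ᵇ x<y , from T-∨ (inj₁ (◁-intro x<y sy≤x)))

∑-mod : ∀ k .{{_ : NonZero k}} q → ∑< (q * k) (_% k) ≡ q * (k C 2)
∑-mod k zero    = refl
∑-mod k (suc q) = begin
  ∑< (k + q * k) (_% k)                          ≡⟨ cong (λ m → ∑< m (_% k)) (+-comm k (q * k)) ⟩
  ∑< (q * k + k) (_% k)                          ≡⟨ ∑-split (q * k) k (_% k) ⟩
  ∑< (q * k) (_% k) + ∑< k (λ j → (q * k + j) % k) ≡⟨ cong₂ _+_ (∑-mod k q) (∑-cong k residue) ⟩
  q * (k C 2) + ∑< k (λ j → 0 + j)               ≡⟨ cong (q * (k C 2) +_) (∑-arith k 0) ⟩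
  q * (k C 2) + (k * 0 + k C 2)                  ≡⟨ cong (λ t → q * (k C 2) + (t + k C 2)) (*-zeroʳ k) ⟩
  q * (k C 2) + k C 2                            ≡⟨ +-comm (q * (k C 2)) (k C 2) ⟩
  suc q * (k C 2)                                ∎
  where
  open ≡-Reasoning
  residue : ∀ {j} → j < k → (q * k + j) % k ≡ j
  residue {j} j<k = begin
    (q * k + j) % k  ≡⟨ cong (_% k) (+-comm (q * k) j) ⟩
    (j + q * k) % k  ≡⟨ [m+kn]%n≡m%n j q k ⟩
    j % k            ≡⟨ m<n⇒m%n≡m j<k ⟩
    j                ∎

-- Block windows: the window of v is the block [⌊v/k⌋k, ⌊v/k⌋k + k) of length k
-- containing v, except that windows are pushed back to end at n, so the
-- vertices after the last complete block share the window [n - k, n).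
blockStart : (k n : ℕ) .{{_ : NonZero k}} → ℕ → ℕ
blockStart k n v = (v / k) * k ⊓ (n ∸ k)

module BlockWindows (k n : ℕ) .{{_ : NonZero k}} (k≤n : k ≤ n) where

  s : ℕ → ℕ
  s = blockStart k n

  s≤ : ∀ v → s v ≤ v
  s≤ v = ≤-trans (m⊓n≤m _ _) (m/n*n≤m v k)

  <block-end : ∀ v → v < (v / k) * k + k
  <block-end v = begin-strict
    v                    ≡⟨ m≡m%n+[m/n]*n v k ⟩
    v % k + (v / k) * k  <⟨ +-monoˡ-< ((v / k) * k) (m%n<n v k) ⟩
    k + (v / k) * k      ≡⟨ +-comm k _ ⟩
    (v / k) * k + k      ∎
    where open ≤-Reasoning

  n∸k+k : n ∸ k + k ≡ n
  n∸k+k = m∸n+n≡m k≤n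

  <s+k : ∀ {v} → v < n → v < s v + k
  <s+k {v} v<n = subst (v <_) (sym (+-distribʳ-⊓ k ((v / k) * k) (n ∸ k)))
                   (⊓-pres-m< (<block-end v) (subst (v <_) (sym n∸k+k) v<n))

  s+k≤n : ∀ v → s v + k ≤ n
  s+k≤n v = subst (s v + k ≤_) n∸k+k (+-monoˡ-≤ k (m⊓n≤n _ _))

  nested : ∀ {v y} → s v ≤ y → y < s v + k → s y ≤ s v
  nested {v} {y} _ y<sv+k = ⊓-glb (≤-trans (m⊓n≤m _ _) (*-monoˡ-≤ k same-block)) (m⊓n≤n _ _)
    where
    y<next : y < suc (v / k) * k
    y<next = <-≤-trans y<sv+k (≤-trans (+-monoˡ-≤ k (m⊓n≤m _ _)) (≤-reflexive (+-comm _ k)))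
    same-block : y / k ≤ v / k
    same-block = ≤-pred (m<n*o⇒m/o<n y<next)

  s1≡0 : 1 < k → s 1 ≡ 0
  s1≡0 1<k = cong (λ d → d * k ⊓ (n ∸ k)) (m<n⇒m/n≡0 1<k)

  q r : ℕ
  q = n / k
  r = n % k

  n≡qk+r : n ≡ q * k + r
  n≡qk+r = trans (m≡m%n+[m/n]*n n k) (+-comm r (q * k))

  in-blocks : ∀ {v} → v < q * k → v ∸ s v ≡ v % k
  in-blocks {v} v<qk = begin
    v ∸ s v          ≡⟨ cong (v ∸_) (m≤n⇒m⊓n≡m block≤n∸k) ⟩
    v ∸ (v / k) * k  ≡⟨ sym (m%n≡m∸m/n*n v k) ⟩
    v % k            ∎
    where
    open ≡-Reasoning
    block≤n∸k : (v / k) * k ≤ n ∸ k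
    block≤n∸k = m+n≤o⇒m≤o∸n _ (≤-trans (≤-reflexive (+-comm _ k))
                  (≤-trans (*-monoˡ-≤ k {suc (v / k)} {q} (m<n*o⇒m/o<n v<qk)) (m/n*n≤m n k)))

  after-blocks : ∀ {j} → j < r → (q * k + j) ∸ s (q * k + j) ≡ (k ∸ r) + j
  after-blocks {j} j<r = begin
    (q * k + j) ∸ s (q * k + j)         ≡⟨ cong ((q * k + j) ∸_) (m≥n⇒m⊓n≡n n∸k≤block) ⟩
    (q * k + j) ∸ (n ∸ k)               ≡⟨ cong (_∸ (n ∸ k)) (cong (_+ j) (sym n∸k+[k∸r])) ⟩
    (n ∸ k + (k ∸ r)) + j ∸ (n ∸ k)     ≡⟨ cong (_∸ (n ∸ k)) (+-assoc (n ∸ k) (k ∸ r) j) ⟩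
    n ∸ k + ((k ∸ r) + j) ∸ (n ∸ k)     ≡⟨ m+n∸m≡n (n ∸ k) _ ⟩
    (k ∸ r) + j                         ∎
    where
    open ≡-Reasoning
    r≤k : r ≤ k
    r≤k = <⇒≤ (m%n<n n k)
    n∸k+[k∸r] : n ∸ k + (k ∸ r) ≡ q * k
    n∸k+[k∸r] = +-cancelʳ-≡ r _ _ (begin
      n ∸ k + (k ∸ r) + r    ≡⟨ +-assoc (n ∸ k) (k ∸ r) r ⟩
      n ∸ k + (k ∸ r + r)    ≡⟨ cong (n ∸ k +_) (m∸n+n≡m r≤k) ⟩
      n ∸ k + k              ≡⟨ n∸k+k ⟩
      n                      ≡⟨ n≡qk+r ⟩
      q * k + r              ∎)
    q≤ : q ≤ (q * k + j) / k
    q≤ = subst (_≤ (q * k + j) / k) (m*n/n≡m q k) (/-monoˡ-≤ k (m≤m+n (q * k) j))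
    n∸k≤block : n ∸ k ≤ ((q * k + j) / k) * k
    n∸k≤block = ≤-trans (m≤n+o⇒m∸n≤o n k (subst (_≤ k + q * k) (sym n≡qk+r)
                  (subst (q * k + r ≤_) (+-comm (q * k) k) (+-monoʳ-≤ (q * k) r≤k))))
                  (*-monoˡ-≤ k q≤)

  edge-sum : ∑< n (λ v → v ∸ s v) ≡ q * (k C 2) + r C 2 + r * (k ∸ r)
  edge-sum = begin
    ∑< n (λ v → v ∸ s v)                                          ≡⟨ cong (λ m → ∑< m (λ v → v ∸ s v)) n≡qk+r ⟩
    ∑< (q * k + r) (λ v → v ∸ s v)                                ≡⟨ ∑-split (q * k) r _ ⟩
    ∑< (q * k) (λ v → v ∸ s v) + ∑< r (λ j → (q * k + j) ∸ s (q * k + j))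
      ≡⟨ cong₂ _+_ (∑-cong (q * k) in-blocks) (∑-cong r after-blocks) ⟩
    ∑< (q * k) (_% k) + ∑< r (λ j → (k ∸ r) + j)                  ≡⟨ cong₂ _+_ (∑-mod k q) (∑-arith r (k ∸ r)) ⟩
    q * (k C 2) + (r * (k ∸ r) + r C 2)                            ≡⟨ regroup (q * (k C 2)) (r * (k ∸ r)) (r C 2) ⟩
    q * (k C 2) + r C 2 + r * (k ∸ r)                              ∎
    where
    open ≡-Reasoning
    regroup : ∀ a b c → a + (b + c) ≡ a + c + b
    regroup = solve-∀

proposition5p1 : (k n : ℕ) → .{{_ : NonZero k}} → 2 ≤ k → k ≤ n →
    Σ (Graph n) λ G →
      DenseStar k G
      × edgeCount G ≡ (n / k) * (k C 2) + ((n % k) C 2) + (n % k) * (k ∸ n % k)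
proposition5p1 k n 2≤k k≤n =
  G , (dense , not-denser (s1≡0 2≤k)) , trans edgeCount-window edge-sum
  where
  open BlockWindows k n k≤n
  open WindowGraph 2≤k s s≤ <s+k s+k≤n nested
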